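{- If $H$ is a standard component of a standard graph $G$, then $H$ is an element of at least one standard decomposition of $G$.
   Context: A labeled graph $G$: finite node set, directed edges without loops, integer labeling $\ell_G$ of the nodes. $G$ is standard if all labels are $\ge0$ and $\ell_G(a)\le\ell_G(b)$ for each edge $(a,b)$. For graphs with the same nodes and edges, $\oplus,\ominus$ add/subtract labels nodewise. A standard component of $G$ is a labeled graph $H$ with the same nodes and edges as $G$, all labels in $\{0,1\}$, such that $H$ is standard, $G\ominus H$ is standard, and not all labels of $H$ are zero. A standard decomposition of $G$ is a finite multiset of standard components of $G$ whose sum is $G$. -}

module Defs where

open import Data.Nat using (ℕ)
open import Data.Fin using (Fin)
open import Data.Bool using (Bool; true; false)
open import Data.Integer using (ℤ; _+_; _-_; _≤_; 0ℤ; 1ℤ)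
open import Data.List using (List; []; _∷_; foldr)
open import Data.List.Relation.Unary.All using (All)
open import Data.Product using (Σ; ∃; _×_)
open import Data.Sum using (_⊎_)
open import Relation.Binary.PropositionalEquality using (_≡_)
open import Relation.Nullary using (¬_)

record Graph : Set where
  field
    size   : ℕ
    edge   : Fin size → Fin size → Bool
    noLoop : ∀ a → edge a a ≡ false

open Graph public

-- An integer labeling of the nodes. A labeled graph is a pair (G , ℓ);
-- labeled graphs with the same nodes/edges are labelings of the same G.
Labeling : Graph → Set
Labeling G = Fin (size G) → ℤ

_⊕_ : {G : Graph} → Labeling G → Labeling G → Labeling G
(f ⊕ g) a = f a + g a

_⊖_ : {G : Graph} → Labeling G → Labeling G → Labeling G
(f ⊖ g) a = f a - g a

Standard : (G : Graph) → Labeling G → Set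
Standard G ℓ =
  (∀ a → 0ℤ ≤ ℓ a) × (∀ a b → edge G a b ≡ true → ℓ a ≤ ℓ b)

StandardComponent : (G : Graph) → Labeling G → Labeling G → Set
StandardComponent G ℓ h =
  (∀ a → (h a ≡ 0ℤ) ⊎ (h a ≡ 1ℤ)) ×
  Standard G h ×
  Standard G (_⊖_ {G} ℓ h) ×
  (∃ λ a → ¬ (h a ≡ 0ℤ))

sumLabelings : (G : Graph) → List (Labeling G) → Labeling G
sumLabelings G []       a = 0ℤ
sumLabelings G (h ∷ hs) a = h a + sumLabelings G hs a

-- standard decomposition: a list (multiset) of standard components summing to ℓ
StandardDecomposition : (G : Graph) → Labeling G → List (Labeling G) → Set
StandardDecomposition G ℓ hs =
  All (StandardComponent G ℓ) hs × (∀ a → sumLabelings G hs a ≡ ℓ a)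

module Submission where

-- Let H be a standard component of the standard graph (G , ℓ).
-- The remainder R = ℓ ⊖ H is standard, so it is a natural-number labeling d
-- that is monotone along edges.  Such a labeling is the sum of its level
-- sets: for k = 1 , … , N (N the largest label of d) the indicator
-- L_k(a) = [k ≤ d a] is a 0/1 labeling, monotone along edges, and nonzero
-- at a node where d is maximal.  Moreover ℓ ⊖ L_k = (d ∸ L_k) + H is
-- standard, so every L_k is a standard component of ℓ, and
-- L_1 + … + L_N = d = ℓ ⊖ H.  Hence H , L_N , … , L_1 is a standard
-- decomposition of ℓ containing H.

open import Defs
open import Data.Bool using (true)
open import Data.Fin using (Fin; zero; suc)
open import Data.Integer as ℤ using (ℤ; +_; _+_; _-_; 0ℤ; ∣_∣; +≤+)
import Data.Integer.Properties as ℤ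
open import Data.Integer.Tactic.RingSolver using (solve-∀)
open import Data.List using (List; []; _∷_)
open import Data.List.Membership.Propositional using (_∈_)
open import Data.List.Relation.Unary.All using (All; []; _∷_)
open import Data.List.Relation.Unary.Any using (here)
open import Data.Nat as ℕ using (ℕ; zero; suc; _∸_; _⊓_; z≤n; s≤s; _≤?_)
import Data.Nat.Properties as ℕ
open import Data.Product using (Σ; ∃; _×_; _,_; proj₁; proj₂)
open import Data.Sum using (_⊎_; inj₁; inj₂) renaming (map to ⊎-map)
open import Relation.Binary.PropositionalEquality
open import Relation.Nullary using (yes; no; contradiction)

indicator : ℕ → ℕ → ℕ
indicator k m with k ≤? m
... | yes _ = 1
... | no  _ = 0

indicator-0∨1 : ∀ k m → indicator k m ≡ 0 ⊎ indicator k m ≡ 1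
indicator-0∨1 k m with k ≤? m
... | yes _ = inj₂ refl
... | no  _ = inj₁ refl

indicator-≡1 : ∀ {k m} → k ℕ.≤ m → indicator k m ≡ 1
indicator-≡1 {k} {m} k≤m with k ≤? m
... | yes _   = refl
... | no  k≰m = contradiction k≤m k≰m

indicator-mono : ∀ k {m n} → m ℕ.≤ n → indicator k m ℕ.≤ indicator k n
indicator-mono k {m} {n} m≤n with k ≤? m | k ≤? n
... | yes _   | yes _   = ℕ.≤-refl
... | yes k≤m | no  k≰n = contradiction (ℕ.≤-trans k≤m m≤n) k≰n
... | no  _   | _       = z≤n

indicator-≤ : ∀ k m → indicator (suc k) m ℕ.≤ m
indicator-≤ k m with suc k ≤? m
... | yes k<m = ℕ.≤-trans (s≤s z≤n) k<m
... | no  _   = z≤n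

-- ... and removing it keeps heights ordered, because every node of the
-- upper set that is removed is at least as high as any node outside it.
∸-indicator-mono : ∀ k {m n} → m ℕ.≤ n →
  m ∸ indicator (suc k) m ℕ.≤ n ∸ indicator (suc k) n
∸-indicator-mono k {m} {n} m≤n with suc k ≤? m | suc k ≤? n
... | yes _   | yes _   = ℕ.∸-monoˡ-≤ 1 m≤n
... | yes k<m | no  k≮n = contradiction (ℕ.≤-trans k<m m≤n) k≮n
... | no  k≮m | yes k<n = ℕ.<⇒≤pred (ℕ.<-≤-trans (ℕ.≰⇒> k≮m) k<n)
... | no  _   | no  _   = m≤n

indicator-+-⊓ : ∀ k m → indicator (suc k) m ℕ.+ k ⊓ m ≡ suc k ⊓ m
indicator-+-⊓ k m with suc k ≤? m
... | yes k<m = trans (cong suc (ℕ.m≤n⇒m⊓n≡m (ℕ.<⇒≤ k<m))) (sym (ℕ.m≤n⇒m⊓n≡m k<m))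
... | no  k≮m = trans (ℕ.m≥n⇒m⊓n≡n m≤k) (sym (ℕ.m≥n⇒m⊓n≡n (ℕ.m≤n⇒m≤1+n m≤k)))
  where
  m≤k : m ℕ.≤ k
  m≤k = ℕ.≤-pred (ℕ.≰⇒> k≮m)

module Levels {G : Graph} (d : Fin (size G) → ℕ)
              (d-mono : ∀ a b → edge G a b ≡ true → d a ℕ.≤ d b) where

  level : ℕ → Labeling G
  level k a = + indicator k (d a)

  level-standard : ∀ k → Standard G (level k)
  level-standard k = (λ _ → +≤+ z≤n) , λ a b e → +≤+ (indicator-mono k (d-mono a b e))

  levels : ℕ → List (Labeling G)
  levels zero    = []
  levels (suc k) = level (suc k) ∷ levels k

  levels-sum : ∀ N a → sumLabelings G (levels N) a ≡ + (N ⊓ d a)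
  levels-sum zero    a = refl
  levels-sum (suc k) a = begin
    level (suc k) a + sumLabelings G (levels k) a ≡⟨ cong (λ s → level (suc k) a + s) (levels-sum k a) ⟩
    + (indicator (suc k) (d a) ℕ.+ k ⊓ d a)       ≡⟨ cong (+_) (indicator-+-⊓ k (d a)) ⟩
    + (suc k ⊓ d a)                                ∎
    where open ≡-Reasoning

  -- If ℓ = d + h with h standard, every nonempty positive level set of d
  -- is a standard component of ℓ: its complement is (d ∸ L) + h.
  module _ (ℓ h : Labeling G) (ℓ≡d+h : ∀ a → ℓ a ≡ + d a + h a)
           (h-standard : Standard G h) where

    complement : ∀ k a →
      (_⊖_ {G} ℓ (level (suc k))) a ≡ + (d a ∸ indicator (suc k) (d a)) + h a
    complement k a = begin
      ℓ a - level (suc k) a           ≡⟨ cong (_- level (suc k) a) (ℓ≡d+h a) ⟩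
      (+ d a + h a) - level (suc k) a ≡⟨ swap (+ d a) (h a) (level (suc k) a) ⟩
      (+ d a - level (suc k) a) + h a ≡⟨ cong (_+ h a) (ℤ.m-n≡m⊖n (d a) (indicator (suc k) (d a))) ⟩
      (d a ℤ.⊖ indicator (suc k) (d a)) + h a
        ≡⟨ cong (_+ h a) (ℤ.⊖-≥ (indicator-≤ k (d a))) ⟩
      + (d a ∸ indicator (suc k) (d a)) + h a ∎
      where
      open ≡-Reasoning
      swap : ∀ (x y z : ℤ) → (x + y) - z ≡ (x - z) + y
      swap = solve-∀

    complement-standard : ∀ k → Standard G (_⊖_ {G} ℓ (level (suc k)))
    complement-standard k =
      (λ a → subst (0ℤ ℤ.≤_) (sym (complement k a)) (ℤ.+-mono-≤ (+≤+ z≤n) (h≥0 a))) ,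
      λ a b e → subst₂ ℤ._≤_ (sym (complement k a)) (sym (complement k b))
        (ℤ.+-mono-≤ (+≤+ (∸-indicator-mono k (d-mono a b e))) (h-mono a b e))
      where
      h≥0 : ∀ a → 0ℤ ℤ.≤ h a
      h≥0 = proj₁ h-standard
      h-mono : ∀ a b → edge G a b ≡ true → h a ℤ.≤ h b
      h-mono = proj₂ h-standard

    level-component : ∀ k w → suc k ℕ.≤ d w → StandardComponent G ℓ (level (suc k))
    level-component k w k<dw =
      (λ a → ⊎-map (cong (+_)) (cong (+_)) (indicator-0∨1 (suc k) (d a))) ,
      level-standard (suc k) , complement-standard k ,
      (w , λ L≡0 → contradiction (trans (sym (cong (+_) (indicator-≡1 k<dw))) L≡0) λ ())

    -- Below the height of a fixed node w every positive level set is nonempty.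
    levels-components : ∀ w N → N ℕ.≤ d w → All (StandardComponent G ℓ) (levels N)
    levels-components w zero    _     = []
    levels-components w (suc k) k<dw =
      level-component k w k<dw ∷ levels-components w k (ℕ.<⇒≤ k<dw)

argmax : ∀ {n} → Fin n → (f : Fin n → ℕ) → ∃ λ m → ∀ a → f a ℕ.≤ f m
argmax {suc zero}    _ f = zero , λ { zero → ℕ.≤-refl }
argmax {suc (suc n)} _ f with argmax {suc n} zero (λ a → f (suc a))
... | m , f∘suc≤fm with f zero ≤? f (suc m)
...   | yes f0≤fm = suc m , λ { zero → f0≤fm ; (suc a) → f∘suc≤fm a }
...   | no  f0≰fm = zero  , λ { zero → ℕ.≤-refl
                              ; (suc a) → ℕ.≤-trans (f∘suc≤fm a) (ℕ.<⇒≤ (ℕ.≰⇒> f0≰fm)) }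

standard-as-ℕ : (G : Graph) (r : Labeling G) → Standard G r →
  Σ (Fin (size G) → ℕ) λ d → (∀ a → + d a ≡ r a) × (∀ a b → edge G a b ≡ true → d a ℕ.≤ d b)
standard-as-ℕ G r (r≥0 , r-mono) =
  (λ a → ∣ r a ∣) , +∣r∣≡r ,
  λ a b e → ℤ.drop‿+≤+ (subst₂ ℤ._≤_ (sym (+∣r∣≡r a)) (sym (+∣r∣≡r b)) (r-mono a b e))
  where
  +∣r∣≡r : ∀ a → + ∣ r a ∣ ≡ r a
  +∣r∣≡r a = ℤ.0≤i⇒+∣i∣≡i (r≥0 a)

corollary2p10 : (G : Graph) (ℓ h : Labeling G) →
    Standard G ℓ → StandardComponent G ℓ h →
    Σ (List (Labeling G)) (λ hs → StandardDecomposition G ℓ hs × h ∈ hs)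
corollary2p10 G ℓ h _ h-comp@(_ , h-standard , rest-standard , (w , _))
  with standard-as-ℕ G (_⊖_ {G} ℓ h) rest-standard
... | d , d≡ℓ-h , d-mono with argmax w d
...   | top , d≤dtop =
  (h ∷ levels (d top)) ,
  (h-comp ∷ levels-components ℓ h ℓ≡d+h h-standard top (d top) ℕ.≤-refl , sum≡ℓ) ,
  here refl
  where
  open Levels d d-mono
  ℓ≡d+h : ∀ a → ℓ a ≡ + d a + h a
  ℓ≡d+h a = trans (cancel (ℓ a) (h a)) (cong (_+ h a) (sym (d≡ℓ-h a)))
    where
    cancel : ∀ (i j : ℤ) → i ≡ (i - j) + j
    cancel = solve-∀
  sum≡ℓ : ∀ a → h a + sumLabelings G (levels (d top)) a ≡ ℓ a
  sum≡ℓ a = begin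
    h a + sumLabelings G (levels (d top)) a ≡⟨ cong (λ s → h a + s) (levels-sum (d top) a) ⟩
    h a + + (d top ⊓ d a)                   ≡⟨ cong (λ n → h a + + n) (ℕ.m≥n⇒m⊓n≡n (d≤dtop a)) ⟩
    h a + + d a                             ≡⟨ ℤ.+-comm (h a) (+ d a) ⟩
    + d a + h a                             ≡⟨ sym (ℓ≡d+h a) ⟩
    ℓ a                                     ∎
    where open ≡-Reasoning
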